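{- Let $\textsc{prop}$ be a finite set of propositional variables and $w\notin\textsc{prop}$ a further propositional variable. Then (1) $\mathrm{PL}_{\{\mathsf{3xor}\}}[\textsc{prop}]\le_{pc}\mathrm{PL}_{\{\mathsf{oxor}\}}[\textsc{prop}\cup\{w\}]$, and (2) $\mathrm{PL}_{\{\mathsf{3xor}\}}[\textsc{prop}]\le_{pc}\mathrm{PL}_{\{\mathsf{aimp}\}}[\textsc{prop}\cup\{w\}]$.
   Context: Boolean functions: $\mathsf{3xor}(x,y,z)=x\oplus y\oplus z$, $\mathsf{oxor}(x,y,z)=x\lor(y\oplus z)$, $\mathsf{aimp}(x,y,z)=x\land(y\to z)$. For a set $O$ of Boolean functions and finite set $P$ of variables, $\mathrm{PL}_O[P]$ is the set of propositional formulas over variables in $P$ using only connectives from $O$, viewed as a concept class $(C,E,\lambda)$ with concepts $C$ the formulas, examples $E$ the truth assignments to $P$, and $\lambda(\phi)$ the set of assignments satisfying $\phi$. For concept classes $\mathcal{C}_1=(C_1,E_1,\lambda_1)$, $\mathcal{C}_2=(C_2,E_2,\lambda_2)$, $\mathcal{C}_1\le_{pc}\mathcal{C}_2$ means there are functions $f:C_1\to C_2$, $h:E_1\to E_2$ such that (i) for all $c\in C_1$, $e\in E_1$: $e\in\lambda_1(c)$ iff $h(e)\in\lambda_2(f(c))$; and (ii) for each $e\in E_2$, either $e\in\lambda_2(f(c))$ for all $c\in C_1$, or for no $c\in C_1$, or there is $e'\in E_1$ with $\{c\in C_1: e\in\lambda_2(f(c))\}=\{c\in C_1: e'\in\lambda_1(c)\}$.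 -}

module Defs where

open import Data.Bool using (Bool; true; false; _∧_; _∨_; _xor_; not)
open import Data.Unit using (⊤; tt)
open import Data.Maybe using (Maybe; just; nothing)
open import Data.Fin using (Fin)
open import Data.Nat using (ℕ)
open import Data.Product using (Σ; _×_; ∃)
open import Data.Sum using (_⊎_)
open import Relation.Nullary using (¬_)
open import Relation.Binary.PropositionalEquality using (_≡_)
open import Function.Bundles using (_⇔_)

3xor : Bool → Bool → Bool → Bool
3xor x y z = x xor y xor z

oxor : Bool → Bool → Bool → Bool
oxor x y z = x ∨ (y xor z)

aimp : Bool → Bool → Bool → Bool
aimp x y z = x ∧ (not y ∨ z)

record Connectives : Set₁ where
  field
    Op  : Set
    ⟦_⟧op : Op → Bool → Bool → Bool → Bool
open Connectives public

single : (Bool → Bool → Bool → Bool) → Connectives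
single g = record { Op = ⊤ ; ⟦_⟧op = λ _ → g }

data Form (O : Connectives) (P : Set) : Set where
  var : P → Form O P
  app : Op O → Form O P → Form O P → Form O P → Form O P

eval : {O : Connectives} {P : Set} → (P → Bool) → Form O P → Bool
eval ρ (var p) = ρ p
eval {O} ρ (app o φ ψ χ) = ⟦_⟧op O o (eval ρ φ) (eval ρ ψ) (eval ρ χ)

-- Concept classes (C, E, λ); membership  e ∈ λ(c)  is written  Mem e c
record ConceptClass : Set₁ where
  field
    Concept : Set
    Example : Set
    Mem     : Example → Concept → Set
open ConceptClass public

PL : Connectives → Set → ConceptClass
PL O P = record
  { Concept = Form O P
  ; Example = P → Bool
  ; Mem     = λ ρ φ → eval ρ φ ≡ true
  }

-- Polynomial-time-free "≤pc" reduction as in the paper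
_≤pc_ : ConceptClass → ConceptClass → Set
𝒞₁ ≤pc 𝒞₂ =
  Σ (Concept 𝒞₁ → Concept 𝒞₂) λ f →
  Σ (Example 𝒞₁ → Example 𝒞₂) λ h →
    ((c : Concept 𝒞₁) (e : Example 𝒞₁) →
       Mem 𝒞₁ e c ⇔ Mem 𝒞₂ (h e) (f c))
  × ((e : Example 𝒞₂) →
       ((c : Concept 𝒞₁) → Mem 𝒞₂ e (f c))
     ⊎ ((c : Concept 𝒞₁) → ¬ Mem 𝒞₂ e (f c))
     ⊎ Σ (Example 𝒞₁) λ e′ → (c : Concept 𝒞₁) → Mem 𝒞₂ e (f c) ⇔ Mem 𝒞₁ e′ c)

-- prop = Fin n ; prop ∪ {w} = Maybe (Fin n) with w = nothing (so w ∉ prop)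
PROP : ℕ → Set
PROP n = Fin n

PROP+w : ℕ → Set
PROP+w n = Maybe (Fin n)

-- A fresh variable w acts as a guard. For oxor, w = false makes oxor w y z = y xor z,
-- so a 3xor formula is simulated by nesting two guarded xors; w = true makes every
-- translated formula true. For aimp, w = true makes aimp w y z = y → z, in which
-- 3xor is expressible by a fixed implication gadget; w = false makes every translated
-- formula false. Either way an assignment to prop ∪ {w} behaves on translated formulas
-- like a constant or like its restriction to prop, which is exactly condition (ii).
module Submission where

open import Defs
open import Data.Nat using (ℕ)
open import Data.Product using (Σ; _×_; _,_)
open import Data.Sum using (_⊎_; inj₁; inj₂)
open import Data.Bool using (Bool; true; false; not; _≟_)
open import Data.Bool.Properties using (¬-not; xor-assoc; xor-identityʳ)
open import Data.Unit using (tt)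
open import Data.Maybe using (Maybe; just; nothing; maybe′)
open import Function using (_∘_)
open import Function.Bundles using (_⇔_; mk⇔)
open import Relation.Nullary using (¬_; yes; no)
open import Relation.Binary.PropositionalEquality using (_≡_; _≢_; refl; sym; trans)

≡⇒true⇔true : {x y : Bool} → x ≡ y → (x ≡ true) ⇔ (y ≡ true)
≡⇒true⇔true x≡y = mk⇔ (λ x≡t → trans (sym x≡y) x≡t) (λ y≡t → trans x≡y y≡t)

constant⇒all-or-none : {A : Set} (g : A → Bool) (c : Bool) → (∀ a → g a ≡ c) →
  (∀ a → g a ≡ true) ⊎ (∀ a → g a ≢ true)
constant⇒all-or-none g true  g≡c = inj₁ g≡c
constant⇒all-or-none g false g≡c = inj₂ λ a ga≡t → false≢true (trans (sym (g≡c a)) ga≡t)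
  where
  false≢true : false ≢ true
  false≢true ()

module _ {O O′ : Connectives} {P : Set} where

  guarded-≤pc : (w c : Bool) (f : Form O P → Form O′ (Maybe P)) →
    (∀ ρ → ρ nothing ≡ w → ∀ φ → eval ρ (f φ) ≡ eval (ρ ∘ just) φ) →
    (∀ ρ → ρ nothing ≡ not w → ∀ φ → eval ρ (f φ) ≡ c) →
    PL O P ≤pc PL O′ (Maybe P)
  guarded-≤pc w c f faithful constant =
    f , (λ ρ → maybe′ ρ w) , (λ φ ρ → ≡⇒true⇔true (sym (faithful (maybe′ ρ w) refl φ))) , classify
    where
    classify : (ρ : Maybe P → Bool) →
        ((φ : Form O P) → eval ρ (f φ) ≡ true)
      ⊎ ((φ : Form O P) → ¬ eval ρ (f φ) ≡ true)
      ⊎ Σ (P → Bool) λ ρ′ → (φ : Form O P) → (eval ρ (f φ) ≡ true) ⇔ (eval ρ′ φ ≡ true)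
    classify ρ with ρ nothing ≟ w
    ... | yes guard = inj₂ (inj₂ (ρ ∘ just , λ φ → ≡⇒true⇔true (faithful ρ guard φ)))
    ... | no ¬guard with constant⇒all-or-none (eval ρ ∘ f) c (constant ρ (¬-not ¬guard))
    ...   | inj₁ all  = inj₁ all
    ...   | inj₂ none = inj₂ (inj₁ none)

-- Instantiated at  app tt  it builds a formula and at  aimp  it computes that formula's
-- value, so evaluating a translated formula unfolds to the Boolean gadget definitionally.
xor-gadget : {A : Set} → (A → A → A → A) → A → A → A → A → A
xor-gadget g w a b c = g (g w a (g a b c)) (g w a c) (g (g w a b) (g w b c) (g c b a))

xor-gadget-aimp : ∀ a b c → xor-gadget aimp true a b c ≡ 3xor a b c
xor-gadget-aimp false false false = refl
xor-gadget-aimp false false true  = refl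
xor-gadget-aimp false true  false = refl
xor-gadget-aimp false true  true  = refl
xor-gadget-aimp true  false false = refl
xor-gadget-aimp true  false true  = refl
xor-gadget-aimp true  true  false = refl
xor-gadget-aimp true  true  true  = refl

module _ {P : Set} where

  private
    Oxor = Form (single oxor) (Maybe P)
    Aimp = Form (single aimp) (Maybe P)

    w⁰ : Oxor
    w⁰ = var nothing

    w¹ : Aimp
    w¹ = var nothing

  3xor⇒oxor : Form (single 3xor) P → Oxor
  3xor⇒oxor (var p)       = app tt w⁰ (var (just p)) w⁰
  3xor⇒oxor (app _ φ ψ χ) = app tt w⁰ (app tt w⁰ (3xor⇒oxor φ) (3xor⇒oxor ψ)) (3xor⇒oxor χ)

  3xor⇒oxor-faithful : ∀ ρ → ρ nothing ≡ false → ∀ φ → eval ρ (3xor⇒oxor φ) ≡ eval (ρ ∘ just) φ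
  3xor⇒oxor-faithful ρ w≡f (var p) rewrite w≡f = xor-identityʳ (ρ (just p))
  3xor⇒oxor-faithful ρ w≡f (app _ φ ψ χ)
    rewrite w≡f | 3xor⇒oxor-faithful ρ w≡f φ | 3xor⇒oxor-faithful ρ w≡f ψ | 3xor⇒oxor-faithful ρ w≡f χ
    = xor-assoc (eval (ρ ∘ just) φ) (eval (ρ ∘ just) ψ) (eval (ρ ∘ just) χ)

  3xor⇒oxor-true : ∀ ρ → ρ nothing ≡ true → ∀ φ → eval ρ (3xor⇒oxor φ) ≡ true
  3xor⇒oxor-true ρ w≡t (var p)       rewrite w≡t = refl
  3xor⇒oxor-true ρ w≡t (app _ φ ψ χ) rewrite w≡t = refl

  3xor⇒aimp : Form (single 3xor) P → Aimp
  3xor⇒aimp (var p)       = app tt w¹ w¹ (var (just p))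
  3xor⇒aimp (app _ φ ψ χ) = xor-gadget (app tt) w¹ (3xor⇒aimp φ) (3xor⇒aimp ψ) (3xor⇒aimp χ)

  3xor⇒aimp-faithful : ∀ ρ → ρ nothing ≡ true → ∀ φ → eval ρ (3xor⇒aimp φ) ≡ eval (ρ ∘ just) φ
  3xor⇒aimp-faithful ρ w≡t (var p) rewrite w≡t = refl
  3xor⇒aimp-faithful ρ w≡t (app _ φ ψ χ)
    rewrite w≡t | 3xor⇒aimp-faithful ρ w≡t φ | 3xor⇒aimp-faithful ρ w≡t ψ | 3xor⇒aimp-faithful ρ w≡t χ
    = xor-gadget-aimp (eval (ρ ∘ just) φ) (eval (ρ ∘ just) ψ) (eval (ρ ∘ just) χ)

  3xor⇒aimp-false : ∀ ρ → ρ nothing ≡ false → ∀ φ → eval ρ (3xor⇒aimp φ) ≡ false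
  3xor⇒aimp-false ρ w≡f (var p)       rewrite w≡f = refl
  3xor⇒aimp-false ρ w≡f (app _ φ ψ χ) rewrite w≡f = refl

propositionA7 : (n : ℕ) →
    (PL (single 3xor) (PROP n) ≤pc PL (single oxor) (PROP+w n))
    × (PL (single 3xor) (PROP n) ≤pc PL (single aimp) (PROP+w n))
propositionA7 _ =
    guarded-≤pc false true  3xor⇒oxor 3xor⇒oxor-faithful 3xor⇒oxor-true
  , guarded-≤pc true  false 3xor⇒aimp 3xor⇒aimp-faithful 3xor⇒aimp-false
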